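{- Let $G$ be a connected graph with vertex set $\{1,\dots,n\}$, $n\ge 2$, let $\Phi=(F_1,\dots,F_n)$ be an $n$-tuple of pairwise disjoint graphs, and let $G[\Phi]$ be the generalized lexicographic product. If $\gamma(G)=\gamma_t(G)$, then $\gamma(G[\Phi])=\gamma_t(G[\Phi])$. If $\gamma_t(G[\Phi])=2\gamma(G[\Phi])$, then $\gamma_t(G)=2\gamma(G)$.
   Context: All graphs are finite, simple and undirected. The generalized lexicographic product $G[\Phi]$ is the graph with vertex set $\bigcup_{i=1}^n V(F_i)$ in which each $F_i$ is an induced subgraph, and for $x\in V(F_i)$, $y\in V(F_j)$ with $i\neq j$, $xy$ is an edge iff $ij\in E(G)$. $\gamma(H)$ is the domination number (minimum size of a set $D$ such that every vertex outside $D$ has a neighbor in $D$) and $\gamma_t(H)$ the total domination number (minimum size of a set $S$ such that every vertex of $H$ has a neighbor in $S$). -}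

module Defs where

open import Data.Nat using (ℕ; _≤_)
open import Data.Fin using (_≟_)
open import Relation.Nullary using (yes; no)
open import Data.Fin using (Fin)
open import Data.Bool using (Bool; true; false)
open import Data.List using (List; length)
open import Data.List.Membership.Propositional using (_∈_)
open import Data.Product using (Σ; _×_; _,_; ∃-syntax)
import Data.Empty
open import Data.Sum using (_⊎_)
open import Relation.Binary.PropositionalEquality using (_≡_; _≢_; refl)

record Graph (V : Set) : Set where
  field
    adj   : V → V → Bool
    sym   : ∀ u v → adj u v ≡ adj v u
    irrefl : ∀ v → adj v v ≡ false
open Graph public

Adj : {V : Set} → Graph V → V → V → Set
Adj G u v = adj G u v ≡ true

data Walk {V : Set} (G : Graph V) : V → V → Set where
  here : ∀ v → Walk G v v
  step : ∀ {u w v} → Adj G u w → Walk G w v → Walk G u v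

Connected : {V : Set} → Graph V → Set
Connected G = ∀ u v → Walk G u v

Dominating : {V : Set} → Graph V → List V → Set
Dominating G D = ∀ v → v ∈ D ⊎ (∃[ u ] (u ∈ D × Adj G v u))

TotalDominating : {V : Set} → Graph V → List V → Set
TotalDominating G S = ∀ v → ∃[ u ] (u ∈ S × Adj G v u)

IsDomNum : {V : Set} → Graph V → ℕ → Set
IsDomNum G k = (∃[ D ] (Dominating G D × length D ≡ k))
             × (∀ D → Dominating G D → k ≤ length D)

IsTotDomNum : {V : Set} → Graph V → ℕ → Set
IsTotDomNum G k = (∃[ S ] (TotalDominating G S × length S ≡ k))
                × (∀ S → TotalDominating G S → k ≤ length S)

-- generalized lexicographic product G[Φ]; F i has m i vertices.
-- Vertex set is the disjoint union Σ i. V(F i).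
LexVertex : (n : ℕ) (m : Fin n → ℕ) → Set
LexVertex n m = Σ (Fin n) (λ i → Fin (m i))

lexAdj : {n : ℕ} {m : Fin n → ℕ} → Graph (Fin n) → ((i : Fin n) → Graph (Fin (m i)))
       → LexVertex n m → LexVertex n m → Bool
lexAdj G F (i , x) (j , y) with i ≟ j
... | yes refl = adj (F i) x y
... | no _ = adj G i j

lexAdj-sym : {n : ℕ} {m : Fin n → ℕ} (G : Graph (Fin n)) (F : (i : Fin n) → Graph (Fin (m i)))
           → ∀ u v → lexAdj G F u v ≡ lexAdj G F v u
lexAdj-sym G F (i , x) (j , y) with i ≟ j | j ≟ i
... | yes refl | yes refl = Graph.sym (F i) x y
... | yes refl | no ¬p = Data.Empty.⊥-elim (¬p refl)
... | no ¬p | yes refl = Data.Empty.⊥-elim (¬p refl)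
... | no _ | no _ = Graph.sym G i j

lexAdj-irrefl : {n : ℕ} {m : Fin n → ℕ} (G : Graph (Fin n)) (F : (i : Fin n) → Graph (Fin (m i)))
              → ∀ v → lexAdj G F v v ≡ false
lexAdj-irrefl G F (i , x) with i ≟ i
... | yes refl = irrefl (F i) x
... | no ¬p = Data.Empty.⊥-elim (¬p refl)

lexProduct : {n : ℕ} {m : Fin n → ℕ} → Graph (Fin n) → ((i : Fin n) → Graph (Fin (m i)))
           → Graph (LexVertex n m)
lexProduct G F = record { adj = lexAdj G F ; sym = lexAdj-sym G F ; irrefl = lexAdj-irrefl G F }

-- Every total dominating set is dominating, and adding a neighbour of each vertex of a
-- dominating set makes it totally dominating, so γ(H) ≤ γₜ(H) ≤ 2γ(H) whenever H has no
-- isolated vertex.  Projecting a dominating set of G[Φ] onto the factor indices dominates G,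
-- so γ(G) ≤ γ(G[Φ]); lifting a total dominating set of G to one vertex per fibre totally
-- dominates G[Φ], so γₜ(G[Φ]) ≤ γₜ(G).  Both claims follow by squeezing these inequalities.
module Submission where

open import Defs
open import Data.Nat using (ℕ; _≤_; _*_; _+_; suc; s≤s; z≤n)
open import Data.Nat.Properties using (≤-antisym; ≤-trans; *-monoʳ-≤; ≤-reflexive; +-identityʳ)
open import Data.Fin using (Fin; fromℕ<; _≟_) renaming (zero to fzero; suc to fsuc)
open import Data.Product using (_×_; _,_; proj₁; proj₂; ∃-syntax)
open import Data.Sum using (inj₁; inj₂)
open import Data.List using (List; length; map; _++_)
open import Data.List.Properties using (length-map; length-++)
open import Data.List.Membership.Propositional.Properties using (∈-map⁺; ∈-++⁺ˡ; ∈-++⁺ʳ)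
open import Relation.Nullary using (yes; no)
open import Relation.Binary.PropositionalEquality
  using (_≡_; _≢_; refl; trans; cong; subst; module ≡-Reasoning)
  renaming (sym to ≡-sym)
open import Data.Empty using (⊥-elim)

NoIsolatedVertex : {V : Set} → Graph V → Set
NoIsolatedVertex G = ∀ v → ∃[ u ] Adj G v u

connected⇒noIsolatedVertex : {V : Set} (G : Graph V) → (∀ v → ∃[ w ] v ≢ w)
                           → Connected G → NoIsolatedVertex G
connected⇒noIsolatedVertex G distinct con v with distinct v
... | w , v≢w with con v w
...   | here _ = ⊥-elim (v≢w refl)
...   | step {w = u} v~u _ = u , v~u

Fin≥2-hasDistinct : ∀ {k} (v : Fin (suc (suc k))) → ∃[ w ] v ≢ w
Fin≥2-hasDistinct fzero = fsuc fzero , λ ()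
Fin≥2-hasDistinct (fsuc _) = fzero , λ ()

domNum≤totDomNum : {V : Set} (H : Graph V) {g t : ℕ}
                 → IsDomNum H g → IsTotDomNum H t → g ≤ t
domNum≤totDomNum H (_ , gmin) ((S , tds , refl) , _) = gmin S (λ v → inj₂ (tds v))

length-++-map : {A : Set} (f : A → A) (xs : List A) → length (map f xs ++ xs) ≡ 2 * length xs
length-++-map f xs = begin
  length (map f xs ++ xs)          ≡⟨ length-++ (map f xs) ⟩
  length (map f xs) + length xs    ≡⟨ cong (_+ length xs) (length-map f xs) ⟩
  length xs + length xs            ≡⟨ cong (length xs +_) (≡-sym (+-identityʳ (length xs))) ⟩
  2 * length xs                    ∎
  where open ≡-Reasoning

totDomNum≤2*domNum : {V : Set} (H : Graph V) → NoIsolatedVertex H → {g t : ℕ}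
                   → IsDomNum H g → IsTotDomNum H t → t ≤ 2 * g
totDomNum≤2*domNum {V} H nbr ((D , dom , refl) , _) (_ , tmin) =
  subst (_ ≤_) (length-++-map partner D) (tmin (map partner D ++ D) tds)
  where
  partner : V → V
  partner v = proj₁ (nbr v)
  tds : TotalDominating H (map partner D ++ D)
  tds v with dom v
  ... | inj₁ v∈D = partner v , ∈-++⁺ˡ (∈-map⁺ partner v∈D) , proj₂ (nbr v)
  ... | inj₂ (u , u∈D , v~u) = u , ∈-++⁺ʳ (map partner D) u∈D , v~u

module _ {n : ℕ} (G : Graph (Fin n)) {m : Fin n → ℕ} (nonempty : ∀ i → 1 ≤ m i)
         (F : (i : Fin n) → Graph (Fin (m i))) where

  domNum≤domNum-lex : {g g' : ℕ} → IsDomNum G g → IsDomNum (lexProduct G F) g' → g ≤ g'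
  domNum≤domNum-lex (_ , gmin) ((D , dom , refl) , _) =
    subst (_ ≤_) (length-map proj₁ D) (gmin (map proj₁ D) projDom)
    where
    projDom : Dominating G (map proj₁ D)
    projDom i with dom (i , fromℕ< (nonempty i))
    ... | inj₁ p = inj₁ (∈-map⁺ proj₁ p)
    ... | inj₂ ((j , y) , p , a) with i ≟ j
    ...   | yes refl = inj₁ (∈-map⁺ proj₁ p)
    ...   | no _ = inj₂ (j , ∈-map⁺ proj₁ p , a)

  totDomNum-lex≤totDomNum : {t t' : ℕ} → IsTotDomNum G t → IsTotDomNum (lexProduct G F) t' → t' ≤ t
  totDomNum-lex≤totDomNum ((S , tds , refl) , _) (_ , tmin) =
    subst (_ ≤_) (length-map lift S) (tmin (map lift S) liftTds)
    where
    lift : Fin n → LexVertex n m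
    lift i = i , fromℕ< (nonempty i)
    liftAdj : ∀ {i j} (y : Fin (m i)) → Adj G i j → Adj (lexProduct G F) (i , y) (lift j)
    liftAdj {i} {j} y i~j with i ≟ j
    ... | yes refl with () ← trans (≡-sym i~j) (irrefl G i)
    ... | no _ = i~j
    liftTds : TotalDominating (lexProduct G F) (map lift S)
    liftTds (i , y) with tds i
    ... | j , j∈S , i~j = lift j , ∈-map⁺ lift j∈S , liftAdj y i~j

corollary2p5 : (n : ℕ) → 2 ≤ n → (G : Graph (Fin n)) → Connected G
    → (m : Fin n → ℕ) → (∀ i → 1 ≤ m i) → (F : (i : Fin n) → Graph (Fin (m i)))
    → (g t g' t' : ℕ)
    → IsDomNum G g → IsTotDomNum G t
    → IsDomNum (lexProduct G F) g' → IsTotDomNum (lexProduct G F) t'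
    → (g ≡ t → g' ≡ t') × (t' ≡ 2 * g' → t ≡ 2 * g)
corollary2p5 (suc (suc k)) (s≤s (s≤s z≤n)) G con m nonempty F g t g' t' γ γₜ γ' γₜ' =
  equalFromG , extremalToG
  where
  g≤g' = domNum≤domNum-lex G nonempty F γ γ'
  t'≤t = totDomNum-lex≤totDomNum G nonempty F γₜ γₜ'
  g'≤t' = domNum≤totDomNum (lexProduct G F) γ' γₜ'
  t≤2g = totDomNum≤2*domNum G (connected⇒noIsolatedVertex G Fin≥2-hasDistinct con) γ γₜ

  equalFromG : g ≡ t → g' ≡ t'
  equalFromG refl = ≤-antisym g'≤t' (≤-trans t'≤t g≤g')

  extremalToG : t' ≡ 2 * g' → t ≡ 2 * g
  extremalToG t'≡2g' =
    ≤-antisym t≤2g (≤-trans (*-monoʳ-≤ 2 g≤g') (≤-trans (≤-reflexive (≡-sym t'≡2g')) t'≤t))
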